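{- Let $q_1,q_2\in\mathbb{Z}$, let $X$ be a nonempty finite set and $f\in\mathrm{Bool}(X)$. Suppose $(X_1,\ldots,X_k)$ and $(Y_1,\ldots,Y_l)$ are compositions of $X$ such that all $f_{\mid X_i}$ and all $f_{\mid Y_j}$ are $(q_1,q_2)$-indecomposable and \[f=f_{\mid X_1}\star_{q_1,q_2}\cdots\star_{q_1,q_2}f_{\mid X_k}=f_{\mid Y_1}\star_{q_1,q_2}\cdots\star_{q_1,q_2}f_{\mid Y_l}.\] Then $k=l$ and there exists a permutation $\sigma\in\mathfrak{S}_k$ such that $Y_i=X_{\sigma(i)}$ for all $i\in[k]$.
   Context: A boolean function on a finite set $X$ is a map $f:\mathcal{P}(X)\to\mathbb{Z}$ with $f(\emptyset)=0$; $\mathrm{Bool}(X)$ is the set of them. For $Y\subseteq X$, $f_{\mid Y}$ is the restriction of $f$ to $\mathcal{P}(Y)$. A composition of $X$ is an ordered sequence of nonempty pairwise disjoint subsets with union $X$. For disjoint finite sets $X,Y$, $f\in\mathrm{Bool}(X)$, $g\in\mathrm{Bool}(Y)$, $f\star_{q_1,q_2}g\in\mathrm{Bool}(X\sqcup Y)$ is $f\star_{q_1,q_2}g(A)=q_1^{|A\cap Y|}f(A\cap X)+q_2^{|A\cap X|}g(A\cap Y)$ (with $0^0=1$); this product is associative. For nonempty $X$, $f\in\mathrm{Bool}(X)$ is $(q_1,q_2)$-indecomposable if for every $Y\subseteq X$, $f'\in\mathrm{Bool}(X\setminus Y)$, $f''\in\mathrm{Bool}(Y)$, the equality $f=f'\star_{q_1,q_2}f''$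 implies $Y=\emptyset$ or $Y=X$. -}

module Defs where

open import Data.Nat using (ℕ; zero; suc)
open import Data.Integer using (ℤ; _+_; _*_; _^_; 0ℤ)
open import Data.Fin using (Fin)
open import Data.Fin.Subset using (Subset; _∩_; _∪_; _─_; _⊆_; ⊥; ⊤; ∣_∣; Nonempty)
open import Data.Vec using (Vec; []; _∷_; lookup)
open import Data.Sum using (_⊎_)
open import Data.Product using (_×_)
open import Relation.Binary.PropositionalEquality using (_≡_; _≢_)

-- The ambient finite set is Fin n. A boolean function on a subset Z ⊆ Fin n
-- is represented by a function  Subset n → ℤ  of which only the values on
-- subsets of Z are relevant; it must vanish on the empty set.
BoolFun : ℕ → Set
BoolFun n = Subset n → ℤ

IsBool : ∀ {n} → BoolFun n → Set
IsBool f = f ⊥ ≡ 0ℤ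

star : ∀ {n} → ℤ → ℤ → Subset n → Subset n → BoolFun n → BoolFun n → BoolFun n
star q₁ q₂ X Y f g A = (q₁ ^ ∣ A ∩ Y ∣) * f (A ∩ X) + (q₂ ^ ∣ A ∩ X ∣) * g (A ∩ Y)

⋃ᵛ : ∀ {n k} → Vec (Subset n) k → Subset n
⋃ᵛ [] = ⊥
⋃ᵛ (X ∷ Xs) = X ∪ ⋃ᵛ Xs

-- f|X₁ ⋆ f|X₂ ⋆ ... ⋆ f|Xₖ  (right-nested; the product is associative).
-- The empty product is the zero function on ∅; note star X ∅ f 0 = f on subsets of X,
-- so the one-factor product is f|X₁ as expected.
starProd : ∀ {n k} → ℤ → ℤ → BoolFun n → Vec (Subset n) k → BoolFun n
starProd q₁ q₂ f [] A = 0ℤ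
starProd q₁ q₂ f (X ∷ Xs) = star q₁ q₂ X (⋃ᵛ Xs) f (starProd q₁ q₂ f Xs)

Indecomposable : ∀ {n} → ℤ → ℤ → Subset n → BoolFun n → Set
Indecomposable {n} q₁ q₂ Z f =
  Nonempty Z ×
  (∀ (Y : Subset n) → Y ⊆ Z → ∀ (f′ f″ : BoolFun n) → IsBool f′ → IsBool f″ →
    (∀ A → A ⊆ Z → f A ≡ star q₁ q₂ (Z ─ Y) Y f′ f″ A) →
    (Y ≡ ⊥) ⊎ (Y ≡ Z))

IsComposition : ∀ {n k} → Vec (Subset n) k → Set
IsComposition {n} {k} Xs =
  (∀ i → Nonempty (lookup Xs i)) ×
  (∀ i j → i ≢ j → lookup Xs i ∩ lookup Xs j ≡ ⊥) ×
  (⋃ᵛ Xs ≡ ⊤)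

{-# OPTIONS --safe #-}
-- If f agrees with X ⋆ g on subsets of Z ⊆ X ∪ R (X, R disjoint, g supported on R), then f|Z is
-- the product of its pieces on Z ∖ R and Z ∩ R, so indecomposability of f|Z forces Z ⊆ X or Z ⊆ R.
-- Peeling off X₁, X₂, … one at a time, every block of one composition lies in a block of the other.
-- As blocks are nonempty and disjoint, the two resulting index maps are mutually inverse, and the
-- mutual inclusions give equality of the matched blocks.
module Submission where

open import Defs
open import Data.Nat using (ℕ; suc)
open import Data.Integer using (ℤ; _+_; _*_; _^_; 0ℤ; 1ℤ)
open import Data.Integer.Properties using (*-zeroʳ; *-identityˡ; +-identityˡ)
open import Data.Fin using (Fin; zero; suc; _≟_)
open import Data.Fin.Properties using (suc-injective)
open import Data.Fin.Subset using (Subset; _∈_; _∉_; _⊆_; _∩_; _∪_; _─_; ⊥; ⊤; ∣_∣; Nonempty)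
open import Data.Fin.Subset.Properties
open import Data.Fin.Permutation using (Permutation; _⟨$⟩ʳ_; permutation; ↔⇒≡)
open import Data.Vec using (Vec; []; _∷_; lookup; here; there)
open import Data.Bool using (true; false)
open import Data.Product using (Σ; ∃; _×_; _,_; proj₁; proj₂)
open import Data.Sum using (_⊎_; inj₁; inj₂)
open import Data.Empty using (⊥-elim)
open import Function using (_∘_; case_of_)
open import Relation.Nullary.Decidable using (decidable-stable)
open import Relation.Binary.PropositionalEquality
  using (_≡_; _≢_; refl; sym; trans; subst; cong; cong₂; module ≡-Reasoning)

private
  variable
    n k l : ℕ
    x : Fin n
    p q r s : Subset n

∩≡⊥⇒∉ : p ∩ q ≡ ⊥ → x ∈ p → x ∉ q
∩≡⊥⇒∉ {x = x} p∩q≡⊥ x∈p x∈q = ∉⊥ (subst (x ∈_) p∩q≡⊥ (x∈p∩q⁺ (x∈p , x∈q)))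

x∈p─q⇒x∉q : ∀ (p q : Subset n) → x ∈ p ─ q → x ∉ q
x∈p─q⇒x∉q (_ ∷ p) (true ∷ q) () here
x∈p─q⇒x∉q (_ ∷ p) (false ∷ q) here ()
x∈p─q⇒x∉q (_ ∷ p) (_ ∷ q) (there x∈p─q) (there x∈q) = x∈p─q⇒x∉q p q x∈p─q x∈q

∩-cong-⊆ : s ⊆ r → r ∩ p ≡ r ∩ q → s ∩ p ≡ s ∩ q
∩-cong-⊆ {s = s} {r} {p} {q} s⊆r r∩p≡r∩q = ⊆-antisym (restrict r∩p≡r∩q) (restrict (sym r∩p≡r∩q))
  where
  restrict : ∀ {p′ q′} → r ∩ p′ ≡ r ∩ q′ → s ∩ p′ ⊆ s ∩ q′
  restrict {p′} {q′} eq x∈s∩p′ =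
    let x∈s , x∈p′ = x∈p∩q⁻ s p′ x∈s∩p′
        x∈r∩q′ = subst (_ ∈_) eq (x∈p∩q⁺ (s⊆r x∈s , x∈p′))
    in x∈p∩q⁺ (x∈s , p∩q⊆q r q′ x∈r∩q′)

p∩q≡p∩[p─p∩r] : q ∩ r ≡ ⊥ → p ⊆ q ∪ r → p ∩ q ≡ p ∩ (p ─ p ∩ r)
p∩q≡p∩[p─p∩r] {q = q} {r} {p} q∩r≡⊥ p⊆q∪r = ⊆-antisym to from
  where
  to : p ∩ q ⊆ p ∩ (p ─ p ∩ r)
  to x∈p∩q =
    let x∈p , x∈q = x∈p∩q⁻ p q x∈p∩q
    in x∈p∩q⁺ (x∈p , x∈p∧x∉q⇒x∈p─q x∈p (∩≡⊥⇒∉ q∩r≡⊥ x∈q ∘ p∩q⊆q p r))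
  from : p ∩ (p ─ p ∩ r) ⊆ p ∩ q
  from x∈p∩[p─p∩r] with x∈p∩q⁻ p _ x∈p∩[p─p∩r]
  ... | x∈p , x∈p─p∩r with x∈p∪q⁻ q r (p⊆q∪r x∈p)
  ...   | inj₁ x∈q = x∈p∩q⁺ (x∈p , x∈q)
  ...   | inj₂ x∈r = ⊥-elim (x∈p─q⇒x∉q p (p ∩ r) x∈p─p∩r (x∈p∩q⁺ (x∈p , x∈r)))

∈⋃ᵛ⁻ : ∀ (Xs : Vec (Subset n) k) → x ∈ ⋃ᵛ Xs → ∃ λ i → x ∈ lookup Xs i
∈⋃ᵛ⁻ [] x∈⊥ = ⊥-elim (∉⊥ x∈⊥)
∈⋃ᵛ⁻ (X ∷ Xs) x∈X∪⋃Xs with x∈p∪q⁻ X (⋃ᵛ Xs) x∈X∪⋃Xs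
... | inj₁ x∈X = zero , x∈X
... | inj₂ x∈⋃Xs = let i , x∈Xᵢ = ∈⋃ᵛ⁻ Xs x∈⋃Xs in suc i , x∈Xᵢ

PairwiseDisjoint : Vec (Subset n) k → Set
PairwiseDisjoint Xs = ∀ i j → i ≢ j → lookup Xs i ∩ lookup Xs j ≡ ⊥

PairwiseDisjoint-tail : ∀ X (Xs : Vec (Subset n) k) → PairwiseDisjoint (X ∷ Xs) → PairwiseDisjoint Xs
PairwiseDisjoint-tail _ _ disjoint i j i≢j = disjoint (suc i) (suc j) (i≢j ∘ suc-injective)

PairwiseDisjoint-head : ∀ X (Xs : Vec (Subset n) k) → PairwiseDisjoint (X ∷ Xs) → X ∩ ⋃ᵛ Xs ≡ ⊥
PairwiseDisjoint-head X Xs disjoint = Empty-unique λ (x , x∈X∩⋃Xs) →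
  let x∈X , x∈⋃Xs = x∈p∩q⁻ X (⋃ᵛ Xs) x∈X∩⋃Xs
      j , x∈Xⱼ = ∈⋃ᵛ⁻ Xs x∈⋃Xs
  in ∩≡⊥⇒∉ (disjoint zero (suc j) λ ()) x∈X x∈Xⱼ

⊆-lookup⇒≡ : ∀ (Xs : Vec (Subset n) k) {i j} → PairwiseDisjoint Xs →
  Nonempty (lookup Xs i) → lookup Xs i ⊆ lookup Xs j → i ≡ j
⊆-lookup⇒≡ Xs {i} {j} disjoint (x , x∈Xᵢ) Xᵢ⊆Xⱼ =
  decidable-stable (i ≟ j) λ i≢j → ∩≡⊥⇒∉ (disjoint i j i≢j) x∈Xᵢ (Xᵢ⊆Xⱼ x∈Xᵢ)

mutual-refinement⇒permutation : ∀ (Xs : Vec (Subset n) k) (Ys : Vec (Subset n) l) →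
  PairwiseDisjoint Xs → PairwiseDisjoint Ys →
  (∀ i → Nonempty (lookup Xs i)) → (∀ j → Nonempty (lookup Ys j)) →
  (∀ j → ∃ λ i → lookup Ys j ⊆ lookup Xs i) → (∀ i → ∃ λ j → lookup Xs i ⊆ lookup Ys j) →
  Σ (Permutation l k) λ σ → ∀ j → lookup Ys j ≡ lookup Xs (σ ⟨$⟩ʳ j)
mutual-refinement⇒permutation Xs Ys disjointX disjointY nonemptyX nonemptyY Ys⊆Xs Xs⊆Ys =
  permutation σ τ στ τσ , Yⱼ≡X[σj]
  where
  σ = proj₁ ∘ Ys⊆Xs
  τ = proj₁ ∘ Xs⊆Ys
  στ : ∀ i → σ (τ i) ≡ i
  στ i = sym (⊆-lookup⇒≡ Xs disjointX (nonemptyX i) (⊆-trans (proj₂ (Xs⊆Ys i)) (proj₂ (Ys⊆Xs (τ i)))))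
  τσ : ∀ j → τ (σ j) ≡ j
  τσ j = sym (⊆-lookup⇒≡ Ys disjointY (nonemptyY j) (⊆-trans (proj₂ (Ys⊆Xs j)) (proj₂ (Xs⊆Ys (σ j)))))
  Yⱼ≡X[σj] : ∀ j → lookup Ys j ≡ lookup Xs (σ j)
  Yⱼ≡X[σj] j = ⊆-antisym (proj₂ (Ys⊆Xs j))
    (subst (λ t → lookup Xs (σ j) ⊆ lookup Ys t) (τσ j) (proj₂ (Xs⊆Ys (σ j))))

module _ (q₁ q₂ : ℤ) where

  star-traces : ∀ {P Q A a b} (g h : BoolFun n) → A ∩ P ≡ a → A ∩ Q ≡ b →
    star q₁ q₂ P Q g h A ≡ (q₁ ^ ∣ b ∣) * g a + (q₂ ^ ∣ a ∣) * h b
  star-traces g h refl refl = refl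

  star-cong-⊆ : ∀ {P Q P′ Q′ Z A} (g h : BoolFun n) → Z ∩ P ≡ Z ∩ P′ → Z ∩ Q ≡ Z ∩ Q′ → A ⊆ Z →
    star q₁ q₂ P Q g h A ≡ star q₁ q₂ P′ Q′ g h A
  star-cong-⊆ g h Z∩P≡Z∩P′ Z∩Q≡Z∩Q′ A⊆Z =
    star-traces g h (∩-cong-⊆ A⊆Z Z∩P≡Z∩P′) (∩-cong-⊆ A⊆Z Z∩Q≡Z∩Q′)

  star-⊆ʳ : ∀ {P Q A} (g h : BoolFun n) → IsBool g → P ∩ Q ≡ ⊥ → A ⊆ Q → star q₁ q₂ P Q g h A ≡ h A
  star-⊆ʳ {n} {P} {Q} {A} g h g⊥≡0 P∩Q≡⊥ A⊆Q = begin
    star q₁ q₂ P Q g h A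
      ≡⟨ star-traces g h A∩P≡⊥ A∩Q≡A ⟩
    (q₁ ^ ∣ A ∣) * g ⊥ + (q₂ ^ ∣ ⊥ {n} ∣) * h A
      ≡⟨ cong₂ (λ a m → (q₁ ^ ∣ A ∣) * a + (q₂ ^ m) * h A) g⊥≡0 (∣⊥∣≡0 n) ⟩
    (q₁ ^ ∣ A ∣) * 0ℤ + 1ℤ * h A
      ≡⟨ cong₂ _+_ (*-zeroʳ (q₁ ^ ∣ A ∣)) (*-identityˡ (h A)) ⟩
    0ℤ + h A
      ≡⟨ +-identityˡ (h A) ⟩
    h A ∎
    where
    open ≡-Reasoning
    A∩P≡⊥ : A ∩ P ≡ ⊥
    A∩P≡⊥ = Empty-unique λ (x , x∈A∩P) →
      let x∈A , x∈P = x∈p∩q⁻ A P x∈A∩P in ∩≡⊥⇒∉ P∩Q≡⊥ x∈P (A⊆Q x∈A)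
    A∩Q≡A : A ∩ Q ≡ A
    A∩Q≡A = ⊆-antisym (p∩q⊆p A Q) (λ x∈A → x∈p∩q⁺ (x∈A , A⊆Q x∈A))

  starProd-⊥ : ∀ (f : BoolFun n) → IsBool f → (Xs : Vec (Subset n) k) → IsBool (starProd q₁ q₂ f Xs)
  starProd-⊥ f f⊥≡0 [] = refl
  starProd-⊥ {n} f f⊥≡0 (X ∷ Xs) = begin
    starProd q₁ q₂ f (X ∷ Xs) ⊥
      ≡⟨ star-traces f (starProd q₁ q₂ f Xs) (∩-zeroˡ X) (∩-zeroˡ (⋃ᵛ Xs)) ⟩
    (q₁ ^ ∣ ⊥ {n} ∣) * f ⊥ + (q₂ ^ ∣ ⊥ {n} ∣) * starProd q₁ q₂ f Xs ⊥
      ≡⟨ cong₂ (λ a b → (q₁ ^ ∣ ⊥ {n} ∣) * a + (q₂ ^ ∣ ⊥ {n} ∣) * b) f⊥≡0 (starProd-⊥ f f⊥≡0 Xs) ⟩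
    (q₁ ^ ∣ ⊥ {n} ∣) * 0ℤ + (q₂ ^ ∣ ⊥ {n} ∣) * 0ℤ
      ≡⟨ cong₂ _+_ (*-zeroʳ (q₁ ^ ∣ ⊥ {n} ∣)) (*-zeroʳ (q₂ ^ ∣ ⊥ {n} ∣)) ⟩
    0ℤ ∎
    where open ≡-Reasoning

  indecomposable⇒⊆⊎⊆ : ∀ {X R Z} (f h : BoolFun n) → IsBool f → IsBool h →
    Indecomposable q₁ q₂ Z f → X ∩ R ≡ ⊥ → Z ⊆ X ∪ R →
    (∀ A → A ⊆ Z → f A ≡ star q₁ q₂ X R f h A) → Z ⊆ X ⊎ Z ⊆ R
  indecomposable⇒⊆⊎⊆ {X = X} {R} {Z} f h f⊥≡0 h⊥≡0 (_ , indecomposable) X∩R≡⊥ Z⊆X∪R f≡X⋆R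
    with indecomposable (Z ∩ R) (p∩q⊆p Z R) f h f⊥≡0 h⊥≡0 f≡[Z─Z∩R]⋆[Z∩R]
    where
    f≡[Z─Z∩R]⋆[Z∩R] : ∀ A → A ⊆ Z → f A ≡ star q₁ q₂ (Z ─ Z ∩ R) (Z ∩ R) f h A
    f≡[Z─Z∩R]⋆[Z∩R] A A⊆Z = trans (f≡X⋆R A A⊆Z)
      (star-cong-⊆ f h (p∩q≡p∩[p─p∩r] X∩R≡⊥ Z⊆X∪R)
        (trans (cong (_∩ R) (sym (∩-idem Z))) (∩-assoc Z Z R)) A⊆Z)
  ... | inj₁ Z∩R≡⊥ = inj₁ λ x∈Z → case x∈p∪q⁻ X R (Z⊆X∪R x∈Z) of λ where
    (inj₁ x∈X) → x∈X
    (inj₂ x∈R) → ⊥-elim (∩≡⊥⇒∉ Z∩R≡⊥ x∈Z x∈R)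
  ... | inj₂ Z∩R≡Z = inj₂ λ x∈Z → p∩q⊆q Z R (subst (_ ∈_) (sym Z∩R≡Z) x∈Z)

  indecomposable⇒⊆block : ∀ {Z} (f : BoolFun n) → IsBool f → (Xs : Vec (Subset n) k) →
    PairwiseDisjoint Xs → Indecomposable q₁ q₂ Z f → Z ⊆ ⋃ᵛ Xs →
    (∀ A → A ⊆ ⋃ᵛ Xs → f A ≡ starProd q₁ q₂ f Xs A) → ∃ λ i → Z ⊆ lookup Xs i
  indecomposable⇒⊆block f f⊥≡0 [] _ ((_ , x∈Z) , _) Z⊆⊥ _ = ⊥-elim (∉⊥ (Z⊆⊥ x∈Z))
  indecomposable⇒⊆block f f⊥≡0 (X ∷ Xs) disjoint Z-indecomposable Z⊆X∪⋃Xs f≡X⋆⋃Xs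
    with indecomposable⇒⊆⊎⊆ f (starProd q₁ q₂ f Xs) f⊥≡0 (starProd-⊥ f f⊥≡0 Xs) Z-indecomposable
           (PairwiseDisjoint-head X Xs disjoint) Z⊆X∪⋃Xs (λ A A⊆Z → f≡X⋆⋃Xs A (⊆-trans A⊆Z Z⊆X∪⋃Xs))
  ... | inj₁ Z⊆X = zero , Z⊆X
  ... | inj₂ Z⊆⋃Xs =
    let i , Z⊆Xᵢ = indecomposable⇒⊆block f f⊥≡0 Xs (PairwiseDisjoint-tail X Xs disjoint)
                      Z-indecomposable Z⊆⋃Xs f≡⋆Xs
    in suc i , Z⊆Xᵢ
    where
    f≡⋆Xs : ∀ A → A ⊆ ⋃ᵛ Xs → f A ≡ starProd q₁ q₂ f Xs A
    f≡⋆Xs A A⊆⋃Xs = trans (f≡X⋆⋃Xs A (⊆-trans A⊆⋃Xs (q⊆p∪q X (⋃ᵛ Xs))))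
      (star-⊆ʳ f (starProd q₁ q₂ f Xs) f⊥≡0 (PairwiseDisjoint-head X Xs disjoint) A⊆⋃Xs)

proposition2p8 : (q₁ q₂ : ℤ) (n : ℕ) (f : BoolFun (suc n)) → IsBool f →
    (k l : ℕ) (Xs : Vec (Subset (suc n)) k) (Ys : Vec (Subset (suc n)) l) →
    IsComposition Xs → IsComposition Ys →
    (∀ i → Indecomposable q₁ q₂ (lookup Xs i) f) →
    (∀ j → Indecomposable q₁ q₂ (lookup Ys j) f) →
    (∀ A → f A ≡ starProd q₁ q₂ f Xs A) →
    (∀ A → f A ≡ starProd q₁ q₂ f Ys A) →
    (k ≡ l) × (Σ (Permutation l k) λ σ → ∀ i → lookup Ys i ≡ lookup Xs (σ ⟨$⟩ʳ i))
proposition2p8 q₁ q₂ n f f⊥≡0 k l Xs Ys (nonemptyX , disjointX , ⋃Xs≡⊤) (nonemptyY , disjointY , ⋃Ys≡⊤)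
  Xs-indecomposable Ys-indecomposable f≡⋆Xs f≡⋆Ys =
  let σ , Ys≡Xs∘σ = mutual-refinement⇒permutation Xs Ys disjointX disjointY nonemptyX nonemptyY Ys⊆Xs Xs⊆Ys
  in sym (↔⇒≡ σ) , σ , Ys≡Xs∘σ
  where
  ⊆-≡⊤ : ∀ {U Z : Subset (suc n)} → U ≡ ⊤ → Z ⊆ U
  ⊆-≡⊤ U≡⊤ = ⊆-trans ⊆⊤ (⊆-reflexive (sym U≡⊤))
  Ys⊆Xs : ∀ j → ∃ λ i → lookup Ys j ⊆ lookup Xs i
  Ys⊆Xs j = indecomposable⇒⊆block q₁ q₂ f f⊥≡0 Xs disjointX (Ys-indecomposable j) (⊆-≡⊤ ⋃Xs≡⊤) (λ A _ → f≡⋆Xs A)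
  Xs⊆Ys : ∀ i → ∃ λ j → lookup Xs i ⊆ lookup Ys j
  Xs⊆Ys i = indecomposable⇒⊆block q₁ q₂ f f⊥≡0 Ys disjointY (Xs-indecomposable i) (⊆-≡⊤ ⋃Ys≡⊤) (λ A _ → f≡⋆Ys A)
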